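{- Fix an integer $k\ge2$ and let $\mathcal T_k$, $C_t$, $H_k$, the dependency graph $G_k$ and its terminal strongly connected component with vertex set $\mathcal T_k^\star$ be as in the context. Then for every $t\in\mathcal T_k^\star$, the power series $C_t(z)$ is aperiodic.
   Context: Permutations are finite structures $(A,<_P,<_V)$ with two linear orders (positions and values). Two permutations are $k$-equivalent if they satisfy the same first-order sentences in the language $\{<_P,<_V\}$ of quantifier depth at most $k$; equivalence classes are logical types of order $k$. Let $\mathcal C$ be the set of 231-avoiding permutations, including the empty one. For a type $t$, let $C_t(z)=\sum_{n\ge0} c_{t,n}z^n$ where $c_{t,n}$ is the number of permutations in $\mathcal C$ of size $n$ and type $t$. Let $\mathcal T_k$ be the (finite) set of types $t$ of order $k$ with $C_t\not\equiv0$. Every nonempty $\sigma\in\mathcal C$ decomposes uniquely as $\tau\oplus(1\ominus\pi)$ with $\tau,\pi\in\mathcal C$ (where $\oplus,\ominus$ are direct and skew sums), and the type of $\tau\oplus(1\ominus\pi)$ depends only on the types $t_1,t_2$ of $\tau,\pi$; denote it $H_k(t_1,t_2)$. This gives the system $C_t=F_t(z;(C_u)_{u\in\mathcal T_k}):=\delta_{t,\varnothing}+z\sum_{t_1,t_2\in\mathcal T_k,\,H_k(t_1,t_2)=t}C_{t_1}C_{t_2}$ for $t\in\mathcal T_k$, where $\varnothing$ is the type of the empty permutation. The dependency graph $G_k$ is the directed graph on $\mathcal T_k$ with an edge $u\to t$ iff $\partial F_t/\partial C_u\ne0$. $G_k$ has a unique terminal strongly connected component (a strongly connected component with no edge leaving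 it); $\mathcal T_k^\star$ denotes its vertex set. A power series $\sum a_nz^n$ is periodic if there exist $d\ge2$ and $r$ with $a_n=0$ unless $n\equiv r\pmod d$, and aperiodic otherwise. -}

module Defs where

open import Data.Nat using (ℕ; zero; suc; _+_; _<_; _≤_; _%_; _⊔_)
open import Data.Fin using (Fin; zero; suc; toℕ)
open import Data.List using (List; []; _∷_; _++_; map; length; lookup; upTo)
open import Data.List.Relation.Binary.Permutation.Propositional using (_↭_)
open import Data.Product using (Σ; _×_; _,_; ∃; proj₁)
open import Data.Sum using (_⊎_)
open import Data.Empty using (⊥)
open import Relation.Nullary using (¬_)
open import Relation.Binary.PropositionalEquality using (_≡_)
open import Relation.Binary.Construct.Closure.ReflexiveTransitive using (Star)
open import Function.Bundles using (_⇔_)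

-- Permutations in one-line notation: a word w of length n which is a
-- rearrangement of 0,1,...,n-1.  Positions are the indices Fin n,
-- and the value at position i is  lookup w i.

record Perm : Set where
  constructor perm
  field
    word  : List ℕ
    valid : word ↭ upTo (length word)
open Perm public

size : Perm → ℕ
size σ = length (word σ)

_⊕w_ : List ℕ → List ℕ → List ℕ
σ ⊕w τ = σ ++ map (λ x → length σ + x) τ

1⊖w : List ℕ → List ℕ
1⊖w π = length π ∷ π

Avoids231 : Perm → Set
Avoids231 σ = (i j l : Fin (size σ)) → toℕ i < toℕ j → toℕ j < toℕ l →
  lookup (word σ) l < lookup (word σ) i → lookup (word σ) i < lookup (word σ) j → ⊥

data Formula (m : ℕ) : Set where
  _<P_ : Fin m → Fin m → Formula m
  _<V_ : Fin m → Fin m → Formula m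
  _≐_  : Fin m → Fin m → Formula m
  ¬'   : Formula m → Formula m
  _∧'_ : Formula m → Formula m → Formula m
  ∃'   : Formula (suc m) → Formula m

depth : ∀ {m} → Formula m → ℕ
depth (x <P y) = 0
depth (x <V y) = 0
depth (x ≐ y)  = 0
depth (¬' φ)   = depth φ
depth (φ ∧' ψ) = depth φ ⊔ depth ψ
depth (∃' φ)   = suc (depth φ)

extend : ∀ {m} {A : Set} → A → (Fin m → A) → Fin (suc m) → A
extend a ρ zero    = a
extend a ρ (suc i) = ρ i

Sat : ∀ {m} (w : List ℕ) → Formula m → (Fin m → Fin (length w)) → Set
Sat w (x <P y) ρ = toℕ (ρ x) < toℕ (ρ y)
Sat w (x <V y) ρ = lookup w (ρ x) < lookup w (ρ y)
Sat w (x ≐ y)  ρ = ρ x ≡ ρ y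
Sat w (¬' φ)   ρ = ¬ Sat w φ ρ
Sat w (φ ∧' ψ) ρ = Sat w φ ρ × Sat w ψ ρ
Sat w (∃' φ)   ρ = Σ (Fin (length w)) λ a → Sat w φ (extend a ρ)

empty-env : ∀ {A : Set} → Fin 0 → A
empty-env ()

_≡[_]_ : List ℕ → ℕ → List ℕ → Set
v ≡[ k ] w = (φ : Formula 0) → depth φ ≤ k → Sat v φ empty-env ⇔ Sat w φ empty-env

-- Types in T_k are represented by 231-avoiding permutations (a type
-- t has C_t ≢ 0 iff it is the type of some member of 𝒞).

Vertex : Set
Vertex = Σ Perm Avoids231

wd : Vertex → List ℕ
wd v = word (proj₁ v)

-- Edge u → t of G_k:  ∂F_t/∂C_u ≠ 0, i.e. there is t₂ ∈ T_k with
-- H_k(u,t₂) = t or H_k(t₂,u) = t.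
Edge : ℕ → Vertex → Vertex → Set
Edge k u t = ∃ λ (π : Vertex) →
  ((wd u ⊕w 1⊖w (wd π)) ≡[ k ] wd t) ⊎ ((wd π ⊕w 1⊖w (wd u)) ≡[ k ] wd t)

Reach : ℕ → Vertex → Vertex → Set
Reach k = Star (Edge k)

InTerminalSCC : ℕ → Vertex → Set
InTerminalSCC k t = (u : Vertex) → Reach k t u → Reach k u t

-- Coefficient c_{t,n} of C_t is nonzero iff some 231-avoiding
-- permutation of size n has type t.
CoeffNonzero : ℕ → Vertex → ℕ → Set
CoeffNonzero k t n = ∃ λ (τ : Vertex) → size (proj₁ τ) ≡ n × (wd τ ≡[ k ] wd t)

-- periodic: ∃ d ≥ 2 (written d = 2 + e) and r with a_n = 0 unless
-- n ≡ r (mod d)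
Periodic : (ℕ → Set) → Set
Periodic nz = ∃ λ e → ∃ λ r → (n : ℕ) → nz n → n % (2 + e) ≡ r % (2 + e)

Aperiodic : (ℕ → Set) → Set
Aperiodic nz = ¬ Periodic nz

-- By the Ehrenfeucht–Fraïssé theorem, k-equivalence means that Duplicator wins the k-round
-- back-and-forth game. Winning strategies on τ, τ' and on π, π' combine into one on
-- τ ⊕ (1 ⊖ π), τ' ⊕ (1 ⊖ π'), so k-equivalence is a congruence for the decomposition.
-- Increasing permutations of lengths at least 2^k − 1 are k-equivalent: pebbling a point
-- splits both orders into two shorter ones, and one induces on k.
-- Let t lie in the terminal component and v = t ⊕ (1 ⊖ ι) with ι increasing of length
-- 2^k − 1. Then t → v, so v reaches t. The type of v contains permutations of two
-- consecutive sizes (lengthen ι by one), and by the congruence this property travels along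
-- every edge of G_k. Hence C_t has nonzero coefficients at some n and n + 1, which no
-- period d ≥ 2 allows.

module Submission where

open import Defs
open import Data.Nat using (ℕ; zero; suc; _+_; _<_; _≤_; _%_; _∸_; z≤n; s≤s; s≤s⁻¹)
open import Data.Nat.Properties
open import Data.Nat.DivMod using (%-distribˡ-+; m<n⇒m%n≡m; m%n<n; n%n≡0)
open import Data.Fin as Fin using (Fin; zero; suc; toℕ; fromℕ<)
open import Data.Fin.Properties using (toℕ-injective; toℕ<n; toℕ-fromℕ<; any?)
open import Data.List using (List; []; _∷_; _++_; _∷ʳ_; map; length; lookup; upTo; applyUpTo; tabulate; concat)
open import Data.List.Properties using (length-++; length-map; map-upTo; upTo-∷ʳ; length-upTo; lookup-upTo)
open import Data.List.Membership.Propositional.Properties using (∈-upTo⁻; ∈-lookup)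
open import Data.List.Relation.Binary.Permutation.Propositional using (_↭_; prep; ↭-reflexive; module PermutationReasoning)
open import Data.List.Relation.Binary.Permutation.Propositional.Properties using (∈-resp-↭; map⁺; ∷↭∷ʳ)
import Data.List.Relation.Binary.Permutation.Propositional.Properties as ↭
open import Data.List.Relation.Unary.All as All using (All; []; _∷_)
open import Data.List.Relation.Unary.All.Properties using (++⁺; ++⁻; concat⁺; concat⁻; tabulate⁺; tabulate⁻)
open import Data.Product as Σ using (∃; ∃₂; _×_; _,_; proj₁; proj₂; map₁)
open import Data.Product.Function.NonDependent.Propositional using (_×-⇔_)
open import Data.Sum as Sum using (_⊎_; inj₁; inj₂)
open import Data.Empty using (⊥; ⊥-elim)
open import Function using (id; flip; _∘_; case_of_)
open import Function.Bundles using (_⇔_; mk⇔; Equivalence)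
import Function.Properties.Equivalence as ⇔
open import Function.Related.TypeIsomorphisms using (¬-cong-⇔)
open import Relation.Nullary using (¬_; Dec; yes; no)
open import Relation.Nullary.Decidable using (¬?; _×-dec_)
open import Relation.Binary.PropositionalEquality
open import Relation.Binary.Construct.Closure.ReflexiveTransitive using (ε; _◅_)

open Equivalence using (to; from)

Pos : List ℕ → Set
Pos w = Fin (length w)

point : (w : List ℕ) → Pos w → ℕ × ℕ
point w a = toℕ a , lookup w a

SameOrder : (p p' q q' : ℕ × ℕ) → Set
SameOrder (i , u) (i' , u') (j , v) (j' , v') = (i < i' ⇔ j < j') × (u < u' ⇔ v < v')

SameOrder-subst : ∀ {p₁ p₂ p₁' p₂' q₁ q₂ q₁' q₂'} → p₁ ≡ p₂ → p₁' ≡ p₂' → q₁ ≡ q₂ → q₁' ≡ q₂' →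
  SameOrder p₂ p₂' q₂ q₂' → SameOrder p₁ p₁' q₁ q₁'
SameOrder-subst refl refl refl refl s = s

⇔-both : ∀ {A B : Set} → A → B → A ⇔ B
⇔-both a b = mk⇔ (λ _ → b) (λ _ → a)

⇔-neither : ∀ {A B : Set} → ¬ A → ¬ B → A ⇔ B
⇔-neither ¬a ¬b = mk⇔ (⊥-elim ∘ ¬a) (⊥-elim ∘ ¬b)

+-<-⇔ : ∀ n n' {i i' j j'} → (i < i' ⇔ j < j') → (n + i < n + i' ⇔ n' + j < n' + j')
+-<-⇔ n n' i⇔j = mk⇔ (+-monoʳ-< n' ∘ to i⇔j ∘ +-cancelˡ-< n _ _) (+-monoʳ-< n ∘ from i⇔j ∘ +-cancelˡ-< n' _ _)

-- Ehrenfeucht–Fraïssé games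

-- The pebble pairs placed so far; a record rather than a bare relation so that w and w' can be inferred.
record Pebbling (w w' : List ℕ) : Set₁ where
  constructor pebbling
  field related : Pos w → Pos w' → Set
open Pebbling

_⊆_ : ∀ {w w'} → Pebbling w w' → Pebbling w w' → Set
R ⊆ S = ∀ a b → related R a b → related S a b

∅ : ∀ {w w'} → Pebbling w w'
∅ = pebbling λ _ _ → ⊥

insert : ∀ {w w'} → Pos w → Pos w' → Pebbling w w' → Pebbling w w'
insert a b R = pebbling λ a' b' → (a' ≡ a × b' ≡ b) ⊎ related R a' b'

transpose : ∀ {w w'} → Pebbling w w' → Pebbling w' w
transpose R = pebbling (flip (related R))

PartialIso : ∀ {w w'} → Pebbling w w' → Set
PartialIso {w} {w'} R = ∀ {a b a' b'} → related R a b → related R a' b' →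
  SameOrder (point w a) (point w a') (point w' b) (point w' b')

data Wins {w w'} : ℕ → Pebbling w w' → Set₁ where
  base : ∀ {R} → PartialIso R → Wins zero R
  step : ∀ {k R} → PartialIso R →
    (∀ a → ∃ λ b → Wins k (insert a b R)) → (∀ b → ∃ λ a → Wins k (insert a b R)) →
    Wins (suc k) R

module _ {w w' : List ℕ} where

  Wins⇒PartialIso : ∀ {k} {R : Pebbling w w'} → Wins k R → PartialIso R
  Wins⇒PartialIso (base iso)     = iso
  Wins⇒PartialIso (step iso _ _) = iso

  Wins-suc⇒ : ∀ {k} {R : Pebbling w w'} → Wins (suc k) R → Wins k R
  Wins-suc⇒ {zero}  (step iso _ _)        = base iso
  Wins-suc⇒ {suc k} (step iso forth back) =
    step iso (Σ.map₂ Wins-suc⇒ ∘ forth) (Σ.map₂ Wins-suc⇒ ∘ back)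

  insert-mono : ∀ {a b} {R S : Pebbling w w'} → R ⊆ S → insert a b R ⊆ insert a b S
  insert-mono R⊆S a b = Sum.map₂ (R⊆S a b)

  Wins-⊆ : ∀ {k} {R S : Pebbling w w'} → R ⊆ S → Wins k S → Wins k R
  Wins-⊆ R⊆S (base iso)           = base λ r r' → iso (R⊆S _ _ r) (R⊆S _ _ r')
  Wins-⊆ R⊆S (step iso forth back) =
    step (λ r r' → iso (R⊆S _ _ r) (R⊆S _ _ r'))
      (Σ.map₂ (Wins-⊆ (insert-mono R⊆S)) ∘ forth)
      (Σ.map₂ (Wins-⊆ (insert-mono R⊆S)) ∘ back)

insert-transpose : ∀ {w w'} {R : Pebbling w w'} {a b} → insert b a (transpose R) ⊆ transpose (insert a b R)
insert-transpose _ _ (inj₁ (refl , refl)) = inj₁ (refl , refl)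
insert-transpose _ _ (inj₂ r)             = inj₂ r

PartialIso-transpose : ∀ {w w'} {R : Pebbling w w'} → PartialIso R → PartialIso (transpose R)
PartialIso-transpose iso r r' = Σ.map ⇔.sym ⇔.sym (iso r r')

Wins-transpose : ∀ {k w w'} {R : Pebbling w w'} → Wins k R → Wins k (transpose R)
Wins-transpose {R = R} (base iso)            = base (PartialIso-transpose {R = R} iso)
Wins-transpose {R = R} (step iso forth back) =
  step (PartialIso-transpose {R = R} iso) (Σ.map₂ transposed ∘ back) (Σ.map₂ transposed ∘ forth)
  where
  transposed : ∀ {k a b} → Wins k (insert a b R) → Wins k (insert b a (transpose R))
  transposed g = Wins-⊆ (insert-transpose {R = R}) (Wins-transpose g)

graph : ∀ {m} w w' → (Fin m → Pos w) → (Fin m → Pos w') → Pebbling w w'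
graph _ _ ρ ρ' = pebbling λ a b → ∃ λ i → ρ i ≡ a × ρ' i ≡ b

graph-extend : ∀ {m w w'} {ρ : Fin m → Pos w} {ρ' : Fin m → Pos w'} {a b} →
  insert a b (graph w w' ρ ρ') ⊆ graph w w' (extend a ρ) (extend b ρ')
graph-extend _ _ (inj₁ (refl , refl))  = zero , refl , refl
graph-extend _ _ (inj₂ (i , ρi , ρ'i)) = suc i , ρi , ρ'i

-- The game characterises k-equivalence

≡⇔≮×≯ : ∀ {n} {a a' : Fin n} → a ≡ a' ⇔ (¬ toℕ a < toℕ a' × ¬ toℕ a' < toℕ a)
≡⇔≮×≯ = mk⇔ (λ { refl → <-irrefl refl , <-irrefl refl })
  (λ (≮ , ≯) → toℕ-injective (≤-antisym (≮⇒≥ ≯) (≮⇒≥ ≮)))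

PartialIso⇒≡⇔≡ : ∀ {w w'} {R : Pebbling w w'} → PartialIso R →
  ∀ {a b a' b'} → related R a b → related R a' b' → a ≡ a' ⇔ b ≡ b'
PartialIso⇒≡⇔≡ iso r r' = ⇔.trans ≡⇔≮×≯ (⇔.trans
  (¬-cong-⇔ (proj₁ (iso r r')) ×-⇔ ¬-cong-⇔ (proj₁ (iso r' r))) (⇔.sym ≡⇔≮×≯))

Wins⇒⇔ : ∀ {k m w w'} {R : Pebbling w w'} {ρ ρ'} → Wins k R → (∀ i → related R (ρ i) (ρ' i)) →
  (φ : Formula m) → depth φ ≤ k → Sat w φ ρ ⇔ Sat w' φ ρ'
Wins⇒⇔ g r (x <P y) _ = proj₁ (Wins⇒PartialIso g (r x) (r y))
Wins⇒⇔ g r (x <V y) _ = proj₂ (Wins⇒PartialIso g (r x) (r y))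
Wins⇒⇔ {R = R} g r (x ≐ y) _ = PartialIso⇒≡⇔≡ {R = R} (Wins⇒PartialIso g) (r x) (r y)
Wins⇒⇔ g r (¬' φ)   d = ¬-cong-⇔ (Wins⇒⇔ g r φ d)
Wins⇒⇔ g r (φ ∧' ψ) d = Wins⇒⇔ g r φ (m⊔n≤o⇒m≤o _ _ d) ×-⇔ Wins⇒⇔ g r ψ (m⊔n≤o⇒n≤o _ _ d)
Wins⇒⇔ {R = R} {ρ} {ρ'} (step _ forth back) r (∃' φ) (s≤s d) = mk⇔
  (λ (a , s) → let b , g = forth a in b , to (Wins⇒⇔ g extended φ d) s)
  (λ (b , s) → let a , g = back b in a , from (Wins⇒⇔ g extended φ d) s)
  where
  extended : ∀ {a b} i → related (insert a b R) (extend a ρ i) (extend b ρ' i)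
  extended zero    = inj₁ (refl , refl)
  extended (suc i) = inj₂ (r i)

Sat? : ∀ {m} w (φ : Formula m) (ρ : Fin m → Pos w) → Dec (Sat w φ ρ)
Sat? w (x <P y) ρ = toℕ (ρ x) <? toℕ (ρ y)
Sat? w (x <V y) ρ = lookup w (ρ x) <? lookup w (ρ y)
Sat? w (x ≐ y)  ρ = ρ x Fin.≟ ρ y
Sat? w (¬' φ)   ρ = ¬? (Sat? w φ ρ)
Sat? w (φ ∧' ψ) ρ = Sat? w φ ρ ×-dec Sat? w ψ ρ
Sat? w (∃' φ)   ρ = any? λ a → Sat? w φ (extend a ρ)

SatAll : ∀ {m} w → List (Formula m) → (Fin m → Pos w) → Set
SatAll w φs ρ = All (λ φ → Sat w φ ρ) φs

DepthAll : ∀ {m} → ℕ → List (Formula m) → Set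
DepthAll k φs = All (λ φ → depth φ ≤ k) φs

-- There is no true formula of depth 0 without free variables, so conjunctions are kept as lists
-- and only folded into a formula under a quantifier.
⋀ : ∀ {m} → List (Formula (suc m)) → Formula (suc m)
⋀ []       = zero ≐ zero
⋀ (φ ∷ φs) = φ ∧' ⋀ φs

Sat-⋀ : ∀ {m w} (φs : List (Formula (suc m))) {ρ} → Sat w (⋀ φs) ρ ⇔ SatAll w φs ρ
Sat-⋀ []       = mk⇔ (λ _ → []) (λ _ → refl)
Sat-⋀ (φ ∷ φs) = mk⇔ (λ (s , ss) → s ∷ to (Sat-⋀ φs) ss) (λ { (s ∷ ss) → s , from (Sat-⋀ φs) ss })

depth-⋀ : ∀ {m k} {φs : List (Formula (suc m))} → DepthAll k φs → depth (⋀ φs) ≤ k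
depth-⋀ []       = z≤n
depth-⋀ (d ∷ ds) = ⊔-lub d (depth-⋀ ds)

literal : ∀ {m} w → (Fin m → Pos w) → Formula m → Formula m
literal w ρ φ with Sat? w φ ρ
... | yes _ = φ
... | no  _ = ¬' φ

literal-holds : ∀ {m} w (ρ : Fin m → Pos w) φ → Sat w (literal w ρ φ) ρ
literal-holds w ρ φ with Sat? w φ ρ
... | yes s = s
... | no ¬s = ¬s

literal-depth : ∀ {m} w (ρ : Fin m → Pos w) φ → depth (literal w ρ φ) ≡ depth φ
literal-depth w ρ φ with Sat? w φ ρ
... | yes _ = refl
... | no  _ = refl

literal-⇔ : ∀ {m w w'} (ρ : Fin m → Pos w) {ρ'} φ → Sat w' (literal w ρ φ) ρ' → Sat w φ ρ ⇔ Sat w' φ ρ'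
literal-⇔ {w = w} ρ φ s' with Sat? w φ ρ
... | yes s = ⇔-both s s'
... | no ¬s = ⇔-neither ¬s s'

diagram : ∀ {m} w → (Fin m → Pos w) → List (Formula m)
diagram w ρ = concat (tabulate λ i → concat (tabulate λ j →
  literal w ρ (i <P j) ∷ literal w ρ (i <V j) ∷ []))

All-diagram : ∀ {m w} {ρ : Fin m → Pos w} {P : Formula m → Set} →
  All P (diagram w ρ) ⇔ (∀ i j → P (literal w ρ (i <P j)) × P (literal w ρ (i <V j)))
All-diagram = mk⇔
  (λ all i j → case tabulate⁻ (concat⁻ (tabulate⁻ (concat⁻ all) i)) j of λ { (p ∷ q ∷ []) → p , q })
  (λ f → concat⁺ (tabulate⁺ λ i → concat⁺ (tabulate⁺ λ j → proj₁ (f i j) ∷ proj₂ (f i j) ∷ [])))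

-- hintikka k w ρ holds at ρ' in w' iff Duplicator wins the k-round game from the pebbles ρ, ρ'.
hintikka : ℕ → ∀ {m} w → (Fin m → Pos w) → List (Formula m)
hintikka zero    w ρ = diagram w ρ
hintikka (suc k) w ρ = diagram w ρ ++ everyPointMatched ∷ tabulate (λ a → ∃' (⋀ (next a)))
  where
  next : Pos w → List (Formula (suc _))
  next a = hintikka k w (extend a ρ)
  everyPointMatched : Formula _
  everyPointMatched = ¬' (∃' (⋀ (tabulate λ a → ¬' (⋀ (next a)))))

diagram-depth : ∀ {m} k w (ρ : Fin m → Pos w) → DepthAll k (diagram w ρ)
diagram-depth k w ρ = from All-diagram λ i j →
  subst (_≤ k) (sym (literal-depth w ρ (i <P j))) z≤n , subst (_≤ k) (sym (literal-depth w ρ (i <V j))) z≤n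

hintikka-depth : ∀ k {m} w (ρ : Fin m → Pos w) → DepthAll k (hintikka k w ρ)
hintikka-depth zero    w ρ = diagram-depth zero w ρ
hintikka-depth (suc k) w ρ = ++⁺ (diagram-depth (suc k) w ρ)
  (s≤s (depth-⋀ (tabulate⁺ λ a → depth-⋀ (next a))) ∷ tabulate⁺ λ a → s≤s (depth-⋀ (next a)))
  where
  next : ∀ a → DepthAll k (hintikka k w (extend a ρ))
  next a = hintikka-depth k w (extend a ρ)

hintikka-holds : ∀ k {m} w (ρ : Fin m → Pos w) → SatAll w (hintikka k w ρ) ρ
hintikka-holds zero    w ρ = from All-diagram λ i j → literal-holds w ρ (i <P j) , literal-holds w ρ (i <V j)
hintikka-holds (suc k) w ρ = ++⁺ (hintikka-holds zero w ρ)
  ((λ (b , s) → tabulate⁻ (to (Sat-⋀ _) s) b (next b)) ∷ tabulate⁺ λ a → a , next a)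
  where
  next : ∀ a → Sat w (⋀ (hintikka k w (extend a ρ))) (extend a ρ)
  next a = from (Sat-⋀ _) (hintikka-holds k w (extend a ρ))

diagram⇒PartialIso : ∀ {m w w'} (ρ : Fin m → Pos w) {ρ'} → SatAll w' (diagram w ρ) ρ' →
  PartialIso (graph w w' ρ ρ')
diagram⇒PartialIso ρ s (i , refl , refl) (j , refl , refl) =
  let p , v = to All-diagram s i j in literal-⇔ ρ (i <P j) p , literal-⇔ ρ (i <V j) v

hintikka⇒Wins : ∀ k {m w w'} (ρ : Fin m → Pos w) {ρ'} → SatAll w' (hintikka k w ρ) ρ' →
  Wins k (graph w w' ρ ρ')
hintikka⇒Wins zero ρ s = base (diagram⇒PartialIso ρ s)
hintikka⇒Wins (suc k) {w = w} {w'} ρ {ρ'} s with ++⁻ (diagram w ρ) s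
... | sd , matched ∷ reached = step (diagram⇒PartialIso ρ sd) forth back
  where
  continue : ∀ {a b} → Sat w' (⋀ (hintikka k w (extend a ρ))) (extend b ρ') →
    Wins k (insert a b (graph w w' ρ ρ'))
  continue s = Wins-⊆ (graph-extend {w = w} {w'}) (hintikka⇒Wins k (extend _ ρ) (to (Sat-⋀ _) s))
  forth : ∀ a → ∃ λ b → Wins k (insert a b (graph w w' ρ ρ'))
  forth a = Σ.map₂ continue (tabulate⁻ reached a)
  back : ∀ b → ∃ λ a → Wins k (insert a b (graph w w' ρ ρ'))
  back b with any? (λ a → Sat? w' (⋀ (hintikka k w (extend a ρ))) (extend b ρ'))
  ... | yes (a , s) = a , continue s
  ... | no unmatched = ⊥-elim (matched (b , from (Sat-⋀ _) (tabulate⁺ λ a s → unmatched (a , s))))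

≡[]⇒Wins : ∀ {k w w'} → w ≡[ k ] w' → Wins k (∅ {w} {w'})
≡[]⇒Wins {k} {w} w≡w' = Wins-⊆ (λ _ _ ()) (hintikka⇒Wins k empty-env
  (All.zipWith (λ (d , s) → to (w≡w' _ d) s) (hintikka-depth k w empty-env , hintikka-holds k w empty-env)))

Wins⇒≡[] : ∀ {k w w'} {R : Pebbling w w'} → Wins k R → w ≡[ k ] w'
Wins⇒≡[] g φ = Wins⇒⇔ g (λ ()) φ

-- Direct sums and skew sums

module Juxtaposition (f : ℕ → ℕ) where

  ↑ˡ : ∀ x y → Pos x → Pos (x ++ map f y)
  ↑ˡ (_ ∷ x) y zero    = zero
  ↑ˡ (_ ∷ x) y (suc a) = suc (↑ˡ x y a)

  ↑ʳ : ∀ x y → Pos y → Pos (x ++ map f y)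
  ↑ʳ (_ ∷ x) y       c       = suc (↑ʳ x y c)
  ↑ʳ []      (_ ∷ y) zero    = zero
  ↑ʳ []      (_ ∷ y) (suc c) = suc (↑ʳ [] y c)

  data Side x y : Pos (x ++ map f y) → Set where
    left  : ∀ a → Side x y (↑ˡ x y a)
    right : ∀ c → Side x y (↑ʳ x y c)

  side : ∀ x y z → Side x y z
  side (_ ∷ x) y zero = left zero
  side (_ ∷ x) y (suc z) with side x y z
  ... | left a  = left (suc a)
  ... | right c = right c
  side [] (_ ∷ y) zero = right zero
  side [] (_ ∷ y) (suc z) with side [] y z
  ... | left ()
  ... | right c = right (suc c)

  point-↑ˡ : ∀ x y a → point (x ++ map f y) (↑ˡ x y a) ≡ point x a
  point-↑ˡ (_ ∷ x) y zero    = refl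
  point-↑ˡ (_ ∷ x) y (suc a) = cong (map₁ suc) (point-↑ˡ x y a)

  point-↑ʳ : ∀ x y c → point (x ++ map f y) (↑ʳ x y c) ≡ (length x + toℕ c , f (lookup y c))
  point-↑ʳ (_ ∷ x) y       c       = cong (map₁ suc) (point-↑ʳ x y c)
  point-↑ʳ []      (_ ∷ y) zero    = refl
  point-↑ʳ []      (_ ∷ y) (suc c) = cong (map₁ suc) (point-↑ʳ [] y c)

open Juxtaposition using (left; right)

inl : ∀ x y → Pos x → Pos (x ⊕w y)
inl x = Juxtaposition.↑ˡ (length x +_) x

inr : ∀ x y → Pos y → Pos (x ⊕w y)
inr x = Juxtaposition.↑ʳ (length x +_) x

side : ∀ x y (z : Pos (x ⊕w y)) → Juxtaposition.Side (length x +_) x y z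
side x = Juxtaposition.side (length x +_) x

shift : ℕ → ℕ × ℕ → ℕ × ℕ
shift n (i , u) = n + i , n + u

point-inl : ∀ x y a → point (x ⊕w y) (inl x y a) ≡ point x a
point-inl x = Juxtaposition.point-↑ˡ (length x +_) x

point-inr : ∀ x y c → point (x ⊕w y) (inr x y c) ≡ shift (length x) (point y c)
point-inr x = Juxtaposition.point-↑ʳ (length x +_) x

Bounded : List ℕ → Set
Bounded w = ∀ a → lookup w a < length w

_≺_ : ℕ × ℕ → ℕ × ℕ → Set
(i , u) ≺ (j , v) = i < j × u < v

point-≺-shift : ∀ {x} → Bounded x → ∀ a p → point x a ≺ shift (length x) p
point-≺-shift {x} bx a p = <-≤-trans (toℕ<n a) (m≤m+n _ _) , <-≤-trans (bx a) (m≤m+n _ _)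

inl≺inr : ∀ {x y} → Bounded x → ∀ a c → point (x ⊕w y) (inl x y a) ≺ point (x ⊕w y) (inr x y c)
inl≺inr {x} {y} bx a c =
  subst₂ _≺_ (sym (point-inl x y a)) (sym (point-inr x y c)) (point-≺-shift {x} bx a _)

SameOrder-≺ : ∀ {p p' q q'} → p ≺ p' → q ≺ q' → SameOrder p p' q q'
SameOrder-≺ (i<i' , u<u') (j<j' , v<v') = ⇔-both i<i' j<j' , ⇔-both u<u' v<v'

SameOrder-≻ : ∀ {p p' q q'} → p' ≺ p → q' ≺ q → SameOrder p p' q q'
SameOrder-≻ (i'<i , u'<u) (j'<j , v'<v) =
  ⇔-neither (<-asym i'<i) (<-asym j'<j) , ⇔-neither (<-asym u'<u) (<-asym v'<v)

SameOrder-shift : ∀ n n' {p p' q q'} → SameOrder p p' q q' →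
  SameOrder (shift n p) (shift n p') (shift n' q) (shift n' q')
SameOrder-shift n n' (i⇔j , u⇔v) = +-<-⇔ n n' i⇔j , +-<-⇔ n n' u⇔v

data Juxtaposed {x x' y y'} (R : Pebbling x x') (S : Pebbling y y') :
    Pos (x ⊕w y) → Pos (x' ⊕w y') → Set where
  ⊞ˡ : ∀ {a b} → related R a b → Juxtaposed R S (inl x y a) (inl x' y' b)
  ⊞ʳ : ∀ {c d} → related S c d → Juxtaposed R S (inr x y c) (inr x' y' d)

_⊞_ : ∀ {x x' y y'} → Pebbling x x' → Pebbling y y' → Pebbling (x ⊕w y) (x' ⊕w y')
R ⊞ S = pebbling (Juxtaposed R S)

PartialIso-⊞ : ∀ {x x' y y'} {R : Pebbling x x'} {S : Pebbling y y'} → Bounded x → Bounded x' →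
  PartialIso R → PartialIso S → PartialIso (R ⊞ S)
PartialIso-⊞ {x} {x'} {y} {y'} bx bx' isoR isoS = go
  where
  go : PartialIso (_ ⊞ _)
  go (⊞ˡ {a} {b} r) (⊞ˡ {a'} {b'} r') =
    SameOrder-subst (point-inl x y a) (point-inl x y a') (point-inl x' y' b) (point-inl x' y' b') (isoR r r')
  go (⊞ʳ {c} {d} s) (⊞ʳ {c'} {d'} s') =
    SameOrder-subst (point-inr x y c) (point-inr x y c') (point-inr x' y' d) (point-inr x' y' d')
      (SameOrder-shift (length x) (length x') (isoS s s'))
  go (⊞ˡ {a} {b} _) (⊞ʳ {c} {d} _) = SameOrder-≺ (inl≺inr {x} {y} bx a c) (inl≺inr {x'} {y'} bx' b d)
  go (⊞ʳ {c} {d} _) (⊞ˡ {a} {b} _) = SameOrder-≻ (inl≺inr {x} {y} bx a c) (inl≺inr {x'} {y'} bx' b d)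

insert-⊞ˡ : ∀ {x x' y y'} {R : Pebbling x x'} {S : Pebbling y y'} {a b} →
  insert (inl x y a) (inl x' y' b) (R ⊞ S) ⊆ (insert a b R ⊞ S)
insert-⊞ˡ _ _ (inj₁ (refl , refl)) = ⊞ˡ (inj₁ (refl , refl))
insert-⊞ˡ _ _ (inj₂ (⊞ˡ r))        = ⊞ˡ (inj₂ r)
insert-⊞ˡ _ _ (inj₂ (⊞ʳ s))        = ⊞ʳ s

insert-⊞ʳ : ∀ {x x' y y'} {R : Pebbling x x'} {S : Pebbling y y'} {c d} →
  insert (inr x y c) (inr x' y' d) (R ⊞ S) ⊆ (R ⊞ insert c d S)
insert-⊞ʳ _ _ (inj₁ (refl , refl)) = ⊞ʳ (inj₁ (refl , refl))
insert-⊞ʳ _ _ (inj₂ (⊞ˡ r))        = ⊞ˡ r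
insert-⊞ʳ _ _ (inj₂ (⊞ʳ s))        = ⊞ʳ (inj₂ s)

-- Duplicator plays the two games on the summands side by side.
Wins-⊞ : ∀ {k x x' y y'} {R : Pebbling x x'} {S : Pebbling y y'} → Bounded x → Bounded x' →
  Wins k R → Wins k S → Wins k (R ⊞ S)
Wins-⊞ {R = R} {S} bx bx' (base isoR) gS = base (PartialIso-⊞ {R = R} {S} bx bx' isoR (Wins⇒PartialIso gS))
Wins-⊞ {suc k} {x} {x'} {y} {y'} {R} {S} bx bx' gR@(step isoR forthR backR) gS@(step isoS forthS backS) =
  step (PartialIso-⊞ {R = R} {S} bx bx' isoR isoS) forth back
  where
  forth : ∀ z → ∃ λ z' → Wins k (insert z z' (R ⊞ S))
  forth z with side x y z
  ... | left a  = let b , g = forthR a in inl x' y' b , Wins-⊆ insert-⊞ˡ (Wins-⊞ bx bx' g (Wins-suc⇒ gS))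
  ... | right c = let d , g = forthS c in inr x' y' d , Wins-⊆ insert-⊞ʳ (Wins-⊞ bx bx' (Wins-suc⇒ gR) g)
  back : ∀ z' → ∃ λ z → Wins k (insert z z' (R ⊞ S))
  back z' with side x' y' z'
  ... | left b  = let a , g = backR b in inl x y a , Wins-⊆ insert-⊞ˡ (Wins-⊞ bx bx' g (Wins-suc⇒ gS))
  ... | right d = let c , g = backS d in inr x y c , Wins-⊆ insert-⊞ʳ (Wins-⊞ bx bx' (Wins-suc⇒ gR) g)

data Topped {y y'} (S : Pebbling y y') : Pos (1⊖w y) → Pos (1⊖w y') → Set where
  top   : Topped S zero zero
  below : ∀ {c d} → related S c d → Topped S (suc c) (suc d)

1⊖ᴾ : ∀ {y y'} → Pebbling y y' → Pebbling (1⊖w y) (1⊖w y')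
1⊖ᴾ S = pebbling (Topped S)

PartialIso-1⊖ : ∀ {y y'} {S : Pebbling y y'} → Bounded y → Bounded y' → PartialIso S → PartialIso (1⊖ᴾ S)
PartialIso-1⊖ by by' isoS = go
  where
  go : PartialIso (1⊖ᴾ _)
  go top top = ⇔-neither (<-irrefl refl) (<-irrefl refl) , ⇔-neither (<-irrefl refl) (<-irrefl refl)
  go top (below {c} {d} _) = ⇔-both (s≤s z≤n) (s≤s z≤n) , ⇔-neither (<-asym (by c)) (<-asym (by' d))
  go (below {c} {d} _) top = ⇔-neither (λ ()) (λ ()) , ⇔-both (by c) (by' d)
  go (below s) (below s') = let i⇔j , u⇔v = isoS s s' in +-<-⇔ 1 1 i⇔j , u⇔v

insert-top : ∀ {y y'} {S : Pebbling y y'} → insert zero zero (1⊖ᴾ S) ⊆ 1⊖ᴾ S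
insert-top _ _ (inj₁ (refl , refl)) = top
insert-top _ _ (inj₂ t)             = t

insert-below : ∀ {y y'} {S : Pebbling y y'} {c d} → insert (suc c) (suc d) (1⊖ᴾ S) ⊆ 1⊖ᴾ (insert c d S)
insert-below _ _ (inj₁ (refl , refl)) = below (inj₁ (refl , refl))
insert-below _ _ (inj₂ top)           = top
insert-below _ _ (inj₂ (below s))     = below (inj₂ s)

Wins-1⊖ : ∀ {k y y'} {S : Pebbling y y'} → Bounded y → Bounded y' → Wins k S → Wins k (1⊖ᴾ S)
Wins-1⊖ {S = S} by by' (base isoS) = base (PartialIso-1⊖ {S = S} by by' isoS)
Wins-1⊖ {S = S} by by' g@(step isoS forthS backS) =
  step (PartialIso-1⊖ {S = S} by by' isoS) forth back
  where
  forth : ∀ z → ∃ λ z' → Wins _ (insert z z' (1⊖ᴾ S))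
  forth zero    = zero , Wins-⊆ insert-top (Wins-1⊖ by by' (Wins-suc⇒ g))
  forth (suc c) = let d , g' = forthS c in suc d , Wins-⊆ insert-below (Wins-1⊖ by by' g')
  back : ∀ z' → ∃ λ z → Wins _ (insert z z' (1⊖ᴾ S))
  back zero    = zero , Wins-⊆ insert-top (Wins-1⊖ by by' (Wins-suc⇒ g))
  back (suc d) = let c , g' = backS d in suc c , Wins-⊆ insert-below (Wins-1⊖ by by' g')

-- 231-avoiding permutations

Valid : List ℕ → Set
Valid w = w ↭ upTo (length w)

valid⇒bounded : ∀ {w} → Valid w → Bounded w
valid⇒bounded v a = ∈-upTo⁻ (∈-resp-↭ v (∈-lookup a))

applyUpTo-+ : ∀ {A : Set} (f : ℕ → A) m n → applyUpTo f (m + n) ≡ applyUpTo f m ++ applyUpTo (f ∘ (m +_)) n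
applyUpTo-+ f zero    n = refl
applyUpTo-+ f (suc m) n = cong (f 0 ∷_) (applyUpTo-+ (f ∘ suc) m n)

upTo-+ : ∀ m n → upTo (m + n) ≡ upTo m ++ map (m +_) (upTo n)
upTo-+ m n = trans (applyUpTo-+ id m n) (cong (upTo m ++_) (sym (map-upTo (m +_) n)))

length-⊕ : ∀ x y → length (x ⊕w y) ≡ length x + length y
length-⊕ x y = trans (length-++ x) (cong (length x +_) (length-map (length x +_) y))

⊕-valid : ∀ {x y} → Valid x → Valid y → Valid (x ⊕w y)
⊕-valid {x} {y} vx vy = begin
  x ⊕w y                                         ↭⟨ ↭.++⁺ vx (map⁺ (length x +_) vy) ⟩
  upTo (length x) ++ map (length x +_) (upTo (length y)) ≡⟨ upTo-+ (length x) (length y) ⟨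
  upTo (length x + length y)                     ≡⟨ cong upTo (length-⊕ x y) ⟨
  upTo (length (x ⊕w y))                         ∎
  where open PermutationReasoning

1⊖-valid : ∀ {y} → Valid y → Valid (1⊖w y)
1⊖-valid {y} vy = begin
  length y ∷ y                  ↭⟨ prep (length y) vy ⟩
  length y ∷ upTo (length y)    ↭⟨ ∷↭∷ʳ (length y) (upTo (length y)) ⟩
  upTo (length y) ∷ʳ length y   ≡⟨ upTo-∷ʳ (length y) ⟩
  upTo (suc (length y))         ∎
  where open PermutationReasoning

Pattern231 : (p q r : ℕ × ℕ) → Set
Pattern231 (i , u) (j , v) (l , t) = i < j × j < l × t < u × u < v

Pattern231-subst : ∀ {p p' q q' r r'} → p ≡ p' → q ≡ q' → r ≡ r' → Pattern231 p q r → Pattern231 p' q' r'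
Pattern231-subst refl refl refl pat = pat

Pattern231-unshift : ∀ n {p q r} → Pattern231 (shift n p) (shift n q) (shift n r) → Pattern231 p q r
Pattern231-unshift n (i<j , j<l , t<u , u<v) =
  +-cancelˡ-< n _ _ i<j , +-cancelˡ-< n _ _ j<l , +-cancelˡ-< n _ _ t<u , +-cancelˡ-< n _ _ u<v

Avoids : List ℕ → Set
Avoids w = ∀ i j l → ¬ Pattern231 (point w i) (point w j) (point w l)

Avoids231⇒Avoids : ∀ {σ} → Avoids231 σ → Avoids (word σ)
Avoids231⇒Avoids av i j l (i<j , j<l , t<u , u<v) = av i j l i<j j<l t<u u<v

Avoids⇒Avoids231 : ∀ {σ} → Avoids (word σ) → Avoids231 σ
Avoids⇒Avoids231 av i j l i<j j<l t<u u<v = av i j l (i<j , j<l , t<u , u<v)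

-- A 231 pattern cannot straddle the two summands, since the left one lies entirely below-left of the right one.
⊕-avoids : ∀ {x y} → Bounded x → Avoids x → Avoids y → Avoids (x ⊕w y)
⊕-avoids {x} {y} bx ax ay i j l pat@(i<j , j<l , t<u , _) with side x y i | side x y j | side x y l
... | left a  | left a'  | left a''  =
  ax a a' a'' (Pattern231-subst (point-inl x y a) (point-inl x y a') (point-inl x y a'') pat)
... | right c | right c' | right c'' = ay c c' c'' (Pattern231-unshift (length x)
  (Pattern231-subst (point-inr x y c) (point-inr x y c') (point-inr x y c'') pat))
... | left a  | _        | right c   = <-asym (proj₂ (inl≺inr {x} {y} bx a c)) t<u
... | right c | left a   | _         = <-asym (proj₁ (inl≺inr {x} {y} bx a c)) i<j
... | _       | right c  | left a    = <-asym (proj₁ (inl≺inr {x} {y} bx a c)) j<l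

1⊖-avoids : ∀ {y} → Bounded y → Avoids y → Avoids (1⊖w y)
1⊖-avoids by ay zero    (suc c)  _         (_ , _ , _ , u<v)       = <-asym (by c) u<v
1⊖-avoids by ay _       zero     _         (() , _)
1⊖-avoids by ay _       (suc _)  zero      (_ , () , _)
1⊖-avoids by ay (suc c) (suc c') (suc c'') (i<j , j<l , t<u , u<v) = ay c c' c'' (s≤s⁻¹ i<j , s≤s⁻¹ j<l , t<u , u<v)

bounded : (u : Vertex) → Bounded (wd u)
bounded u = valid⇒bounded (valid (proj₁ u))

avoids : (u : Vertex) → Avoids (wd u)
avoids u = Avoids231⇒Avoids {proj₁ u} (proj₂ u)

vertex : (w : List ℕ) → Valid w → Avoids w → Vertex
vertex w v av = perm w v , Avoids⇒Avoids231 {perm w v} av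

_⊕1⊖_ : Vertex → Vertex → Vertex
u ⊕1⊖ π = vertex (wd u ⊕w 1⊖w (wd π)) (⊕-valid (valid (proj₁ u)) (1⊖-valid (valid (proj₁ π))))
  (⊕-avoids {wd u} (bounded u) (avoids u) (1⊖-avoids {wd π} (bounded π) (avoids π)))

size-⊕1⊖ : ∀ u π → size (proj₁ (u ⊕1⊖ π)) ≡ size (proj₁ u) + suc (size (proj₁ π))
size-⊕1⊖ u π = length-⊕ (wd u) (1⊖w (wd π))

≡[]-refl : ∀ {k} w → w ≡[ k ] w
≡[]-refl w _ _ = ⇔.refl

≡[]-trans : ∀ {k u v w} → u ≡[ k ] v → v ≡[ k ] w → u ≡[ k ] w
≡[]-trans u≡v v≡w φ d = ⇔.trans (u≡v φ d) (v≡w φ d)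

≡[]-⊕1⊖ : ∀ {k} {u u' π π' : Vertex} → wd u ≡[ k ] wd u' → wd π ≡[ k ] wd π' →
  wd (u ⊕1⊖ π) ≡[ k ] wd (u' ⊕1⊖ π')
≡[]-⊕1⊖ {u = u} {u'} {π} {π'} u≡u' π≡π' = Wins⇒≡[] (Wins-⊞ (bounded u) (bounded u')
  (≡[]⇒Wins u≡u') (Wins-1⊖ (bounded π) (bounded π') (≡[]⇒Wins π≡π')))

-- Long increasing permutations are k-equivalent

increasing : ℕ → Vertex
increasing n = vertex (upTo n) (↭-reflexive (cong upTo (sym (length-upTo n))))
  λ i j l (i<j , j<l , t<u , _) →
    <-asym (<-trans i<j j<l) (subst₂ _<_ (lookup-upTo n l) (lookup-upTo n i) t<u)

-- 2 ^ k ∸ 1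
bound : ℕ → ℕ
bound zero    = 0
bound (suc k) = suc (bound k + bound k)

Alike : ℕ → ℕ → ℕ → Set
Alike k n m = n ≡ m ⊎ (bound k ≤ n × bound k ≤ m)

Alike-sym : ∀ {k n m} → Alike k n m → Alike k m n
Alike-sym (inj₁ n≡m)        = inj₁ (sym n≡m)
Alike-sym (inj₂ (B≤n , B≤m)) = inj₂ (B≤m , B≤n)

Alike-split : ∀ k a c {m} → Alike (suc k) (suc (a + c)) m →
  ∃₂ λ b d → m ≡ suc (b + d) × Alike k a b × Alike k c d
Alike-split k a c (inj₁ refl) = a , c , refl , inj₁ refl , inj₁ refl
Alike-split k a c {suc m} (inj₂ (s≤s 2B≤a+c , s≤s 2B≤m)) with a <? bound k | c <? bound k
... | yes a<B | _ =
  let B+a≤m = ≤-trans (+-monoʳ-≤ (bound k) (<⇒≤ a<B)) 2B≤m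
      B≤c   = ≮⇒≥ λ c<B → <⇒≱ (+-mono-< a<B c<B) 2B≤a+c
  in a , m ∸ a , cong suc (sym (m+[n∸m]≡n (m+n≤o⇒n≤o (bound k) B+a≤m))) ,
     inj₁ refl , inj₂ (B≤c , m+n≤o⇒m≤o∸n (bound k) B+a≤m)
... | no a≮B | yes c<B =
  let B+c≤m = ≤-trans (+-monoʳ-≤ (bound k) (<⇒≤ c<B)) 2B≤m
  in m ∸ c , c , cong suc (sym (m∸n+n≡m (m+n≤o⇒n≤o (bound k) B+c≤m))) ,
     inj₂ (≮⇒≥ a≮B , m+n≤o⇒m≤o∸n (bound k) B+c≤m) , inj₁ refl
... | no a≮B | no c≮B =
  bound k , m ∸ bound k , cong suc (sym (m+[n∸m]≡n (m+n≤o⇒m≤o (bound k) 2B≤m))) ,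
  inj₂ (≮⇒≥ a≮B , ≤-refl) , inj₂ (≮⇒≥ c≮B , m+n≤o⇒m≤o∸n (bound k) 2B≤m)

single : ∀ {w w'} → Pos w → Pos w' → Pebbling w w'
single a b = insert a b ∅

Wins-single-subst : ∀ {k w₁ w₂ w₁' w₂'} → w₁ ≡ w₂ → w₁' ≡ w₂' →
  ∀ {a₁ a₂ b₁ b₂} → toℕ a₁ ≡ toℕ a₂ → toℕ b₁ ≡ toℕ b₂ →
  Wins k (single {w₂} {w₂'} a₂ b₂) → Wins k (single {w₁} {w₁'} a₁ b₁)
Wins-single-subst refl refl a₁≡a₂ b₁≡b₂ g rewrite toℕ-injective a₁≡a₂ | toℕ-injective b₁≡b₂ = g

pebble : ∀ x y → Pos (x ⊕w (1⊖w [] ⊕w y))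
pebble x y = inr x _ (inl (1⊖w []) y zero)

toℕ-pebble : ∀ x y → toℕ (pebble x y) ≡ length x
toℕ-pebble x y = trans (cong proj₁ (point-inr x _ (inl (1⊖w []) y zero))) (+-identityʳ (length x))

-- Splitting at a pebbled point reduces the pebbled game to games on the two sides.
Wins-pebble : ∀ {k x x' y y'} → Bounded x → Bounded x' →
  Wins k (∅ {x} {x'}) → Wins k (∅ {y} {y'}) → Wins k (single (pebble x y) (pebble x' y'))
Wins-pebble {k} bx bx' gx gy = Wins-⊆ (λ { _ _ (inj₁ (refl , refl)) → ⊞ʳ (⊞ˡ top) })
  (Wins-⊞ bx bx' gx (Wins-⊞ bounded-point bounded-point
    (Wins-1⊖ (λ ()) (λ ()) (≡[]⇒Wins {k} (≡[]-refl []))) gy))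
  where
  bounded-point : Bounded (1⊖w [])
  bounded-point zero = s≤s z≤n

upTo-pebbled : ∀ a c → upTo (suc (a + c)) ≡ upTo a ⊕w (1⊖w [] ⊕w upTo c)
upTo-pebbled a c = begin
  upTo (suc (a + c))                  ≡⟨ cong upTo (+-suc a c) ⟨
  upTo (a + suc c)                    ≡⟨ upTo-+ a (suc c) ⟩
  upTo a ++ map (a +_) (upTo (suc c)) ≡⟨ cong₂ (λ n l → upTo a ++ map (n +_) l) (sym (length-upTo a)) (upTo-+ 1 c) ⟩
  upTo a ⊕w (1⊖w [] ⊕w upTo c)        ∎
  where open ≡-Reasoning

upTo-Wins : ∀ k {n m} → Alike k n m → Wins k (∅ {upTo n} {upTo m})
upTo-Wins zero    _   = base λ ()
upTo-Wins (suc k) {n} {m} n~m = step (λ ()) (respond n~m) λ b →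
  Σ.map₂ (λ g → Wins-⊆ (insert-transpose {R = ∅ {upTo m} {upTo n}}) (Wins-transpose g))
    (respond (Alike-sym {suc k} n~m) b)
  where
  respond : ∀ {n m} → Alike (suc k) n m → (z : Pos (upTo n)) → ∃ λ z' → Wins k (single z z')
  respond {n} {m} n~m z =
    let a   = toℕ z
        a<n = subst (a <_) (length-upTo n) (toℕ<n z)
        c   = n ∸ suc a
        n≡  = sym (m+[n∸m]≡n a<n)
        b , d , m≡ , a~b , c~d = Alike-split k a c (subst (λ n → Alike (suc k) n m) n≡ n~m)
        b<m = subst (b <_) (sym (trans (length-upTo m) m≡)) (s≤s (m≤m+n b d))
    in fromℕ< b<m ,
       Wins-single-subst (trans (cong upTo n≡) (upTo-pebbled a c)) (trans (cong upTo m≡) (upTo-pebbled b d))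
         (sym (trans (toℕ-pebble (upTo a) (upTo c)) (length-upTo a)))
         (trans (toℕ-fromℕ< b<m) (sym (trans (toℕ-pebble (upTo b) (upTo d)) (length-upTo b))))
         (Wins-pebble (bounded (increasing a)) (bounded (increasing b)) (upTo-Wins k a~b) (upTo-Wins k c~d))

-- Terminal components are aperiodic

∣_∣ : Vertex → ℕ
∣ v ∣ = size (proj₁ v)

record ConsecutiveSizes (k : ℕ) (w : List ℕ) : Set where
  field
    smaller larger : Vertex
    smaller≡       : wd smaller ≡[ k ] w
    larger≡        : wd larger ≡[ k ] w
    size-larger    : ∣ larger ∣ ≡ suc ∣ smaller ∣

ConsecutiveSizes-edge : ∀ {k u t} → ConsecutiveSizes k (wd u) → Edge k u t → ConsecutiveSizes k (wd t)
ConsecutiveSizes-edge {u = u} cs (π , inj₁ uπ≡t) = record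
  { smaller     = smaller ⊕1⊖ π
  ; larger      = larger ⊕1⊖ π
  ; smaller≡    = ≡[]-trans (≡[]-⊕1⊖ {u = smaller} {u} {π} {π} smaller≡ (≡[]-refl (wd π))) uπ≡t
  ; larger≡     = ≡[]-trans (≡[]-⊕1⊖ {u = larger} {u} {π} {π} larger≡ (≡[]-refl (wd π))) uπ≡t
  ; size-larger = begin
      ∣ larger ⊕1⊖ π ∣              ≡⟨ size-⊕1⊖ larger π ⟩
      ∣ larger ∣ + suc ∣ π ∣         ≡⟨ cong (_+ suc ∣ π ∣) size-larger ⟩
      suc (∣ smaller ∣ + suc ∣ π ∣)  ≡⟨ cong suc (size-⊕1⊖ smaller π) ⟨
      suc ∣ smaller ⊕1⊖ π ∣          ∎
  }
  where open ConsecutiveSizes cs; open ≡-Reasoning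
ConsecutiveSizes-edge {u = u} cs (π , inj₂ πu≡t) = record
  { smaller     = π ⊕1⊖ smaller
  ; larger      = π ⊕1⊖ larger
  ; smaller≡    = ≡[]-trans (≡[]-⊕1⊖ {u = π} {π} {smaller} {u} (≡[]-refl (wd π)) smaller≡) πu≡t
  ; larger≡     = ≡[]-trans (≡[]-⊕1⊖ {u = π} {π} {larger} {u} (≡[]-refl (wd π)) larger≡) πu≡t
  ; size-larger = begin
      ∣ π ⊕1⊖ larger ∣               ≡⟨ size-⊕1⊖ π larger ⟩
      ∣ π ∣ + suc ∣ larger ∣          ≡⟨ cong (λ n → ∣ π ∣ + suc n) size-larger ⟩
      ∣ π ∣ + suc (suc ∣ smaller ∣)   ≡⟨ +-suc ∣ π ∣ (suc ∣ smaller ∣) ⟩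
      suc (∣ π ∣ + suc ∣ smaller ∣)   ≡⟨ cong suc (size-⊕1⊖ π smaller) ⟨
      suc ∣ π ⊕1⊖ smaller ∣           ∎
  }
  where open ConsecutiveSizes cs; open ≡-Reasoning

ConsecutiveSizes-reach : ∀ {k u t} → Reach k u t → ConsecutiveSizes k (wd u) → ConsecutiveSizes k (wd t)
ConsecutiveSizes-reach ε        cs = cs
ConsecutiveSizes-reach {u = u} (_◅_ {j = v} e es) cs =
  ConsecutiveSizes-reach es (ConsecutiveSizes-edge {u = u} {v} cs e)

ConsecutiveSizes-padded : ∀ k t → ConsecutiveSizes k (wd (t ⊕1⊖ increasing (bound k)))
ConsecutiveSizes-padded k t = record
  { smaller     = t ⊕1⊖ increasing B
  ; larger      = t ⊕1⊖ increasing (suc B)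
  ; smaller≡    = ≡[]-refl _
  ; larger≡     = ≡[]-⊕1⊖ {u = t} {t} {increasing (suc B)} {increasing B} (≡[]-refl (wd t))
                    (Wins⇒≡[] (upTo-Wins k (inj₂ (n≤1+n B , ≤-refl))))
  ; size-larger = begin
      ∣ t ⊕1⊖ increasing (suc B) ∣          ≡⟨ size-⊕1⊖ t (increasing (suc B)) ⟩
      ∣ t ∣ + suc ∣ increasing (suc B) ∣     ≡⟨ cong (λ n → ∣ t ∣ + suc n) (length-upTo (suc B)) ⟩
      ∣ t ∣ + suc (suc B)                   ≡⟨ +-suc ∣ t ∣ (suc B) ⟩
      suc (∣ t ∣ + suc B)                   ≡⟨ cong (λ n → suc (∣ t ∣ + suc n)) (length-upTo B) ⟨
      suc (∣ t ∣ + suc ∣ increasing B ∣)     ≡⟨ cong suc (size-⊕1⊖ t (increasing B)) ⟨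
      suc ∣ t ⊕1⊖ increasing B ∣             ∎
  }
  where
  B : ℕ
  B = bound k
  open ≡-Reasoning

n%d≢[1+n]%d : ∀ e n → n % (2 + e) ≢ suc n % (2 + e)
n%d≢[1+n]%d e n x≡ with suc (n % (2 + e)) <? 2 + e
... | yes 1+x<d = 1+n≢n (sym (trans x≡ (trans (%-distribˡ-+ 1 n (2 + e)) (m<n⇒m%n≡m 1+x<d))))
... | no  1+x≮d =
  let 1+x≡d = ≤-antisym (m%n<n n (2 + e)) (≮⇒≥ 1+x≮d)
      x≡0   = trans x≡ (trans (%-distribˡ-+ 1 n (2 + e)) (trans (cong (_% (2 + e)) 1+x≡d) (n%n≡0 (2 + e))))
  in 1+n≢0 (suc-injective (trans (sym 1+x≡d) (cong suc x≡0)))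

lemma3p2 : (k : ℕ) → 2 ≤ k → (t : Vertex) → InTerminalSCC k t →
    Aperiodic (CoeffNonzero k t)
lemma3p2 k _ t terminal (e , r , periodic) = n%d≢[1+n]%d e ∣ smaller ∣
  (trans (periodic _ (smaller , refl , smaller≡)) (sym (periodic _ (larger , size-larger , larger≡))))
  where
  padded : Vertex
  padded = t ⊕1⊖ increasing (bound k)
  t→padded : Edge k t padded
  t→padded = increasing (bound k) , inj₁ (≡[]-refl _)
  open ConsecutiveSizes (ConsecutiveSizes-reach (terminal padded (t→padded ◅ ε)) (ConsecutiveSizes-padded k t))
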